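{- For integers $m \ge 1$ and $n \ge 1$, the strong product $P_m \boxtimes P_n$ is a closure, where $P_t$ denotes the path with $t$ edges.
   Context: The strong product $G \boxtimes H$ has vertex set $V(G)\times V(H)$, with distinct $(u,v)$ and $(u',v')$ adjacent if and only if either $uu' \in E(G)$ and $v=v'$, or $vv' \in E(H)$ and $u=u'$, or $uu'\in E(G)$ and $vv' \in E(H)$. Two edges $e, e'$ of a graph $G$ satisfy the relation $\theta$ if there is a sequence of subgraphs $G_1, \dots, G_k$ of $G$, each isomorphic to a triangle $K_3$ or to $K_{2,3}$, such that $e \in E(G_1)$, $e' \in E(G_k)$, and $E(G_i)\cap E(G_{i+1}) \ne \emptyset$ for all $i \in [k-1]$. $G$ is a closure if every two edges of $G$ satisfy $\theta$. -}

module Defs where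

open import Data.Nat using (ℕ; suc)
open import Data.Fin using (Fin; toℕ)
open import Data.Product using (Σ; _×_; _,_; ∃-syntax)
open import Data.Sum using (_⊎_)
open import Relation.Binary.PropositionalEquality using (_≡_; _≢_)

record Graph : Set₁ where
  field
    V   : Set
    Adj : V → V → Set
open Graph public

_⊠_ : Graph → Graph → Graph
G ⊠ H = record
  { V   = V G × V H
  ; Adj = λ { (u , v) (u' , v') →
              (Adj G u u' × v ≡ v')
            ⊎ (Adj H v v' × u ≡ u')
            ⊎ (Adj G u u' × Adj H v v') } }

P : ℕ → Graph
P t = record
  { V   = Fin (suc t)
  ; Adj = λ i j → (suc (toℕ i) ≡ toℕ j) ⊎ (suc (toℕ j) ≡ toℕ i) }

module _ (G : Graph) where
  private
    W = V G
    _~_ = Adj G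

  SamePair : W → W → W → W → Set
  SamePair u v x y = (u ≡ x × v ≡ y) ⊎ (u ≡ y × v ≡ x)

  -- A subgraph of G isomorphic to K₃ or to K₂,₃ (given by its vertices;
  -- its edge set is the edge set of the copy of K₃ / K₂,₃).
  data Block : Set where
    tri : (a b c : W) →
          a ≢ b → a ≢ c → b ≢ c →
          a ~ b → b ~ c → a ~ c → Block
    k23 : (a₁ a₂ b₁ b₂ b₃ : W) →
          a₁ ≢ a₂ → b₁ ≢ b₂ → b₁ ≢ b₃ → b₂ ≢ b₃ →
          a₁ ≢ b₁ → a₁ ≢ b₂ → a₁ ≢ b₃ → a₂ ≢ b₁ → a₂ ≢ b₂ → a₂ ≢ b₃ →
          a₁ ~ b₁ → a₁ ~ b₂ → a₁ ~ b₃ →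
          a₂ ~ b₁ → a₂ ~ b₂ → a₂ ~ b₃ → Block

  EdgeOf : Block → W → W → Set
  EdgeOf (tri a b c _ _ _ _ _ _) u v =
    SamePair u v a b ⊎ SamePair u v b c ⊎ SamePair u v a c
  EdgeOf (k23 a₁ a₂ b₁ b₂ b₃ _ _ _ _ _ _ _ _ _ _ _ _ _ _ _ _) u v =
      SamePair u v a₁ b₁ ⊎ SamePair u v a₁ b₂ ⊎ SamePair u v a₁ b₃
    ⊎ SamePair u v a₂ b₁ ⊎ SamePair u v a₂ b₂ ⊎ SamePair u v a₂ b₃

  ShareEdge : Block → Block → Set
  ShareEdge B B' = ∃[ u ] ∃[ v ] (EdgeOf B u v × EdgeOf B' u v)

  data Chain : Block → Block → Set where
    single : (B : Block) → Chain B B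
    step   : {B₁ B₂ B' : Block} → ShareEdge B₁ B₂ → Chain B₂ B' → Chain B₁ B'

  θ : W → W → W → W → Set
  θ u v u' v' = ∃[ B ] ∃[ B' ] (EdgeOf B u v × EdgeOf B' u' v' × Chain B B')

  IsClosure : Set
  IsClosure = ∀ u v u' v' → u ~ v → u' ~ v' → θ u v u' v'

module Submission where

-- The strong product P m ⊠ P n is a king's-move grid: for every unit cell
-- with lower corner (i , j) its four corners a = (i , j), b = (i+1 , j),
-- c = (i , j+1), d = (i+1 , j+1) are pairwise adjacent, and the three
-- triangles  abd  (lower),  acd  (upper)  and  abc  (skew)  of the cell
-- together contain all six edges of the cell.  Every edge of the grid lies
-- in some cell, so it suffices to connect all these triangles to one fixed
-- triangle (the hub) by chains of triangles sharing edges: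
--   * inside a cell, lower and upper share ad, lower and skew share ab;
--   * the upper triangle of a cell shares cd with the lower triangle of the
--     cell above it, and the lower triangle shares bd with the upper
--     triangle of the cell to its right.

open import Defs
open import Data.Nat using (ℕ; _≥_; suc)
open import Data.Fin using (Fin; zero; suc; inject₁; toℕ)
open import Data.Fin.Properties using (toℕ-injective; toℕ-inject₁; suc-injective)
open import Data.Fin.Induction using (<-weakInduction)
import Data.Nat.Properties as ℕ using (suc-injective)
open import Data.Product using (Σ-syntax; _×_; _,_; proj₁; proj₂)
open import Data.Sum using (inj₁; inj₂; map)
open import Relation.Binary.PropositionalEquality
  using (_≡_; _≢_; refl; sym; trans; cong)

module _ {G : Graph} where

  SamePair-swap : {u v x y : V G} → SamePair G u v x y → SamePair G v u x y
  SamePair-swap (inj₁ (u≡x , v≡y)) = inj₂ (v≡y , u≡x)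
  SamePair-swap (inj₂ (u≡y , v≡x)) = inj₁ (v≡x , u≡y)

  EdgeOf-swap : (B : Block G) {u v : V G} → EdgeOf G B u v → EdgeOf G B v u
  EdgeOf-swap (tri _ _ _ _ _ _ _ _ _) =
    map SamePair-swap (map SamePair-swap SamePair-swap)
  EdgeOf-swap (k23 _ _ _ _ _ _ _ _ _ _ _ _ _ _ _ _ _ _ _ _ _) =
    map SamePair-swap (map SamePair-swap (map SamePair-swap
      (map SamePair-swap (map SamePair-swap SamePair-swap))))

  link : {B B' : Block G} → ShareEdge G B B' → Chain G B B'
  link s = step s (single _)

  infixr 5 _++_
  _++_ : {B₁ B₂ B₃ : Block G} → Chain G B₁ B₂ → Chain G B₂ B₃ → Chain G B₁ B₃
  single _ ++ d = d
  step s c ++ d = step s (c ++ d)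

  ShareEdge-sym : {B B' : Block G} → ShareEdge G B B' → ShareEdge G B' B
  ShareEdge-sym (u , v , e , e') = u , v , e' , e

  reverse : {B B' : Block G} → Chain G B B' → Chain G B' B
  reverse (single B) = single B
  reverse (step s c) = reverse c ++ link (ShareEdge-sym s)

  CoveredFrom : Block G → V G → V G → Set
  CoveredFrom hub u v = Σ[ B ∈ Block G ] (EdgeOf G B u v × Chain G hub B)

  CoveredFrom-swap : {hub : Block G} {u v : V G} →
                     CoveredFrom hub u v → CoveredFrom hub v u
  CoveredFrom-swap (B , e , c) = B , EdgeOf-swap B e , c

  closure-from-hub : (hub : Block G) →
                     (∀ u v → Adj G u v → CoveredFrom hub u v) → IsClosure G
  closure-from-hub hub covered u v u' v' uv u'v'
    with covered u v uv | covered u' v' u'v'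
  ... | B , e , c | B' , e' , c' = B , B' , e , e' , reverse c ++ c'

≢-proj₁ : {A B : Set} {p q : A × B} → proj₁ p ≢ proj₁ q → p ≢ q
≢-proj₁ ne e = ne (cong proj₁ e)

≢-proj₂ : {A B : Set} {p q : A × B} → proj₂ p ≢ proj₂ q → p ≢ q
≢-proj₂ ne e = ne (cong proj₂ e)

-- The skew triangle abc uses the edge u'u, hence the extra field.
record Square (G H : Graph) : Set where
  field
    u u'  : V G
    v v'  : V H
    u~u'  : Adj G u u'
    u'~u  : Adj G u' u
    v~v'  : Adj H v v'
    u≢u'  : u ≢ u'
    v≢v'  : v ≢ v'

module Square-triangles {G H : Graph} (s : Square G H) where
  open Square s

  a b c d : V (G ⊠ H)
  a = u  , v
  b = u' , v
  c = u  , v'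
  d = u' , v'

  lower upper skew : Block (G ⊠ H)
  lower = tri a b d (≢-proj₁ u≢u') (≢-proj₁ u≢u') (≢-proj₂ v≢v')
    (inj₁ (u~u' , refl)) (inj₂ (inj₁ (v~v' , refl))) (inj₂ (inj₂ (u~u' , v~v')))
  upper = tri a c d (≢-proj₂ v≢v') (≢-proj₁ u≢u') (≢-proj₁ u≢u')
    (inj₂ (inj₁ (v~v' , refl))) (inj₁ (u~u' , refl)) (inj₂ (inj₂ (u~u' , v~v')))
  skew = tri a b c (≢-proj₁ u≢u') (≢-proj₂ v≢v') (≢-proj₁ (λ e → u≢u' (sym e)))
    (inj₁ (u~u' , refl)) (inj₂ (inj₂ (u'~u , v~v'))) (inj₂ (inj₁ (v~v' , refl)))

  lower∋ab : EdgeOf (G ⊠ H) lower a b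
  lower∋ab = inj₁ (inj₁ (refl , refl))

  lower∋bd : EdgeOf (G ⊠ H) lower b d
  lower∋bd = inj₂ (inj₁ (inj₁ (refl , refl)))

  lower∋ad : EdgeOf (G ⊠ H) lower a d
  lower∋ad = inj₂ (inj₂ (inj₁ (refl , refl)))

  upper∋ac : EdgeOf (G ⊠ H) upper a c
  upper∋ac = inj₁ (inj₁ (refl , refl))

  upper∋cd : EdgeOf (G ⊠ H) upper c d
  upper∋cd = inj₂ (inj₁ (inj₁ (refl , refl)))

  upper∋ad : EdgeOf (G ⊠ H) upper a d
  upper∋ad = inj₂ (inj₂ (inj₁ (refl , refl)))

  skew∋ab : EdgeOf (G ⊠ H) skew a b
  skew∋ab = inj₁ (inj₁ (refl , refl))

  skew∋cb : EdgeOf (G ⊠ H) skew c b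
  skew∋cb = inj₂ (inj₁ (inj₂ (refl , refl)))

  lower→upper : Chain (G ⊠ H) lower upper
  lower→upper = link (a , d , lower∋ad , upper∋ad)

  upper→lower : Chain (G ⊠ H) upper lower
  upper→lower = link (a , d , upper∋ad , lower∋ad)

  lower→skew : Chain (G ⊠ H) lower skew
  lower→skew = link (a , b , lower∋ab , skew∋ab)

path-forward : {t : ℕ} (i : Fin t) → Adj (P t) (inject₁ i) (suc i)
path-forward i = inj₁ (cong suc (toℕ-inject₁ i))

path-backward : {t : ℕ} (i : Fin t) → Adj (P t) (suc i) (inject₁ i)
path-backward i = inj₂ (cong suc (toℕ-inject₁ i))

inject₁≢suc : {t : ℕ} (i : Fin t) → inject₁ i ≢ suc i
inject₁≢suc zero    ()
inject₁≢suc (suc i) e = inject₁≢suc i (suc-injective e)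

below-suc : {t : ℕ} {x : Fin (suc t)} (i : Fin t) →
            suc (toℕ x) ≡ toℕ (suc i) → x ≡ inject₁ i
below-suc i e = toℕ-injective (trans (ℕ.suc-injective e) (sym (toℕ-inject₁ i)))

data PathEdge {t : ℕ} : Fin (suc t) → Fin (suc t) → Set where
  forward  : (i : Fin t) → PathEdge (inject₁ i) (suc i)
  backward : (i : Fin t) → PathEdge (suc i) (inject₁ i)

path-edge : {t : ℕ} {x y : Fin (suc t)} → Adj (P t) x y → PathEdge x y
path-edge {y = suc i} (inj₁ x+1≡y) with refl ← below-suc i x+1≡y = forward i
path-edge {x = suc i} (inj₂ y+1≡x) with refl ← below-suc i y+1≡x = backward i

data EdgeEnd {t : ℕ} : Fin (suc (suc t)) → Set where
  lower-end : (j : Fin (suc t)) → EdgeEnd (inject₁ j)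
  upper-end : (j : Fin (suc t)) → EdgeEnd (suc j)

edge-end : {t : ℕ} (y : Fin (suc (suc t))) → EdgeEnd y
edge-end zero    = lower-end zero
edge-end (suc j) = upper-end j

module Grid (m' n' : ℕ) where
  m n : ℕ
  m = suc m'
  n = suc n'

  cell : Fin m → Fin n → Square (P m) (P n)
  cell i j = record
    { u = inject₁ i ; u' = suc i ; v = inject₁ j ; v' = suc j
    ; u~u' = path-forward i ; u'~u = path-backward i ; v~v' = path-forward j
    ; u≢u' = inject₁≢suc i ; v≢v' = inject₁≢suc j }

  open module Cell (i : Fin m) (j : Fin n) = Square-triangles (cell i j)

  step-up : (i : Fin m) (j : Fin n') →
            Chain (P m ⊠ P n) (lower i (inject₁ j)) (lower i (suc j))
  step-up i j = lower→upper i (inject₁ j)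
             ++ link (_ , _ , upper∋cd i (inject₁ j) , lower∋ab i (suc j))

  step-right : (i : Fin m') (j : Fin n) →
               Chain (P m ⊠ P n) (lower (inject₁ i) j) (lower (suc i) j)
  step-right i j = link (_ , _ , lower∋bd (inject₁ i) j , upper∋ac (suc i) j)
                ++ upper→lower (suc i) j

  hub : Block (P m ⊠ P n)
  hub = lower zero zero

  lower-reachable : (i : Fin m) (j : Fin n) → Chain (P m ⊠ P n) hub (lower i j)
  lower-reachable i j = column j ++ row i
    where
    column : (j : Fin n) → Chain (P m ⊠ P n) hub (lower zero j)
    column = <-weakInduction (λ j → Chain (P m ⊠ P n) hub (lower zero j))
               (single hub) (λ j c → c ++ step-up zero j)
    row : (i : Fin m) → Chain (P m ⊠ P n) (lower zero j) (lower i j)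
    row = <-weakInduction (λ i → Chain (P m ⊠ P n) (lower zero j) (lower i j))
            (single _) (λ i c → c ++ step-right i j)

  upper-reachable : (i : Fin m) (j : Fin n) → Chain (P m ⊠ P n) hub (upper i j)
  upper-reachable i j = lower-reachable i j ++ lower→upper i j

  skew-reachable : (i : Fin m) (j : Fin n) → Chain (P m ⊠ P n) hub (skew i j)
  skew-reachable i j = lower-reachable i j ++ lower→skew i j

  Covered : V (P m ⊠ P n) → V (P m ⊠ P n) → Set
  Covered = CoveredFrom hub

  horizontal : (i : Fin m) (y : Fin (suc n)) → Covered (inject₁ i , y) (suc i , y)
  horizontal i y with edge-end y
  ... | lower-end j = lower i j , lower∋ab i j , lower-reachable i j
  ... | upper-end j = upper i j , upper∋cd i j , upper-reachable i j

  vertical : (x : Fin (suc m)) (j : Fin n) → Covered (x , inject₁ j) (x , suc j)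
  vertical x j with edge-end x
  ... | lower-end i = upper i j , upper∋ac i j , upper-reachable i j
  ... | upper-end i = lower i j , lower∋bd i j , lower-reachable i j

  diagonal : (i : Fin m) (j : Fin n) → Covered (inject₁ i , inject₁ j) (suc i , suc j)
  diagonal i j = lower i j , lower∋ad i j , lower-reachable i j

  antidiagonal : (i : Fin m) (j : Fin n) → Covered (inject₁ i , suc j) (suc i , inject₁ j)
  antidiagonal i j = skew i j , skew∋cb i j , skew-reachable i j

  cover : ∀ p q → Adj (P m ⊠ P n) p q → Covered p q
  cover (x , y) (x' , y) (inj₁ (x~x' , refl)) with path-edge x~x'
  ... | forward i  = horizontal i y
  ... | backward i = CoveredFrom-swap (horizontal i y)
  cover (x , y) (x , y') (inj₂ (inj₁ (y~y' , refl))) with path-edge y~y'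
  ... | forward j  = vertical x j
  ... | backward j = CoveredFrom-swap (vertical x j)
  cover (x , y) (x' , y') (inj₂ (inj₂ (x~x' , y~y')))
    with path-edge x~x' | path-edge y~y'
  ... | forward i  | forward j  = diagonal i j
  ... | backward i | backward j = CoveredFrom-swap (diagonal i j)
  ... | forward i  | backward j = antidiagonal i j
  ... | backward i | forward j  = CoveredFrom-swap (antidiagonal i j)

lemma4p4 : (m n : ℕ) → m ≥ 1 → n ≥ 1 → IsClosure (P m ⊠ P n)
lemma4p4 (suc m') (suc n') _ _ = closure-from-hub (Grid.hub m' n') (Grid.cover m' n')
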